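{- Let $A\in\mathbb{R}^{m\times N}$ be totally unimodular and of full row rank, and let $b\in\mathbb{Z}^m$. Let $\Gamma>0$, let $\gamma\in\mathbb{R}^m$ with $|\gamma_i|<\frac{\Gamma}{m}$ for $i=1,\dots,m$, and let $b'=b-\gamma$. Let $\mathcal{B}=\{A_{\pi(1)},\dots,A_{\pi(m)}\}$ be a basis formed from columns of $A$, with invertible matrix $B=[A_{\pi(1)},\dots,A_{\pi(m)}]$, and define $\hat{x},x'\in\mathbb{R}^N$ by $\hat{x}_j=(B^{ -1}b)_i$ and $x'_j=(B^{ -1}b')_i$ if $j=\pi(i)$, and $\hat{x}_j=x'_j=0$ otherwise. Then $\|\hat{x}-x'\|^2=\sum_j(\hat{x}_j-x'_j)^2<m\Gamma^2$.
   Context: A matrix is totally unimodular if every square submatrix has determinant in $\{ -1,0,1\}$. A basis is a set of $m$ linearly independent columns of $A$. -}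

module Defs where

open import Level using (Level; _⊔_) renaming (suc to lsuc)
open import Algebra.Bundles using (CommutativeRing)
open import Relation.Binary.Core using (Rel)
open import Relation.Binary.Structures using (IsStrictTotalOrder)
open import Relation.Binary.Definitions using (tri<; tri≈; tri>)
open import Relation.Nullary using (¬_)
open import Data.Nat as ℕ using (ℕ; zero; suc)
open import Data.Integer as ℤ using (ℤ; +_; -[1+_])
open import Data.Fin using (Fin; zero; suc; punchIn)
open import Data.Product using (∃)
open import Data.Sum using (_⊎_)

-- An ordered field: a commutative ring with a strict total order compatible
-- with + and *, in which every nonzero element has a multiplicative inverse.
-- (ℝ is an instance; the theorem is stated for every ordered field.)
record OrderedField (c ℓ₁ ℓ₂ : Level) : Set (lsuc (c ⊔ ℓ₁ ⊔ ℓ₂)) where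
  field
    commutativeRing : CommutativeRing c ℓ₁
  open CommutativeRing commutativeRing public
  field
    _<_                : Rel Carrier ℓ₂
    isStrictTotalOrder : IsStrictTotalOrder _≈_ _<_
    +-mono-<           : ∀ {x y} z → x < y → (x + z) < (y + z)
    *-pos              : ∀ {x y} → 0# < x → 0# < y → 0# < (x * y)
    inverse            : ∀ x → ¬ (x ≈ 0#) → ∃ λ y → (x * y) ≈ 1#
  open IsStrictTotalOrder isStrictTotalOrder public
    using (compare)

module Ops {c ℓ₁ ℓ₂ : Level} (F : OrderedField c ℓ₁ ℓ₂) where
  open OrderedField F using (Carrier; _≈_; _+_; _*_; -_; 0#; 1#; compare)

  Matrix : ℕ → ℕ → Set c
  Matrix m n = Fin m → Fin n → Carrier

  Σ : ∀ {n} → (Fin n → Carrier) → Carrier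
  Σ {zero}  f = 0#
  Σ {suc n} f = f zero + Σ (λ i → f (suc i))

  _⊗_ : ∀ {m n p} → Matrix m n → Matrix n p → Matrix m p
  (M ⊗ P) i k = Σ (λ j → M i j * P j k)

  _·_ : ∀ {m n} → Matrix m n → (Fin n → Carrier) → Fin m → Carrier
  (M · v) i = Σ (λ j → M i j * v j)

  I : ∀ {n} → Matrix n n
  I zero    zero    = 1#
  I zero    (suc _) = 0#
  I (suc _) zero    = 0#
  I (suc i) (suc j) = I i j

  sgn : ℕ → Carrier
  sgn zero    = 1#
  sgn (suc k) = - sgn k

  det : ∀ {n} → Matrix n n → Carrier
  det {zero}  M = 1#
  det {suc n} M =
    Σ (λ j → sgn (Data.Fin.toℕ j) * (M zero j * det (λ i k → M (suc i) (punchIn j k))))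

  fromℕ : ℕ → Carrier
  fromℕ zero    = 0#
  fromℕ (suc n) = 1# + fromℕ n

  fromℤ : ℤ → Carrier
  fromℤ (+ n)      = fromℕ n
  fromℤ -[1+ n ]   = - fromℕ (suc n)

  ∣_∣ : Carrier → Carrier
  ∣ x ∣ with compare x 0#
  ... | tri< _ _ _ = - x
  ... | tri≈ _ _ _ = x
  ... | tri> _ _ _ = x

  TotallyUnimodular : ∀ {m n} → Matrix m n → Set ℓ₁
  TotallyUnimodular {m} {n} A =
    ∀ k (r : Fin k → Fin m) (s : Fin k → Fin n) →
      (∀ {i j} → r i ≡ r j → i ≡ j) →
      (∀ {i j} → s i ≡ s j → i ≡ j) →
      let d = det (λ i j → A (r i) (s j)) in
      (d ≈ - 1#) ⊎ (d ≈ 0#) ⊎ (d ≈ 1#)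
    where open import Relation.Binary.PropositionalEquality using (_≡_)

  FullRowRank : ∀ {m n} → Matrix m n → Set (c ⊔ ℓ₁)
  FullRowRank {m} {n} A =
    ∀ (λ′ : Fin m → Carrier) →
      (∀ j → Σ (λ i → λ′ i * A i j) ≈ 0#) → ∀ i → λ′ i ≈ 0#

  _≈ₘ_ : ∀ {m n} → Matrix m n → Matrix m n → Set ℓ₁
  M ≈ₘ P = ∀ i j → M i j ≈ P i j

module Submission where

open import Defs
open import Level using (Level)
open import Data.Nat as ℕ using (ℕ; _≤_)
open import Data.Integer using (ℤ)
open import Data.Fin using (Fin)
open import Relation.Binary.PropositionalEquality using (_≡_)
open import Relation.Nullary using (¬_)

open import Data.Nat using (zero; suc)
import Data.Nat.Properties as ℕₚ
open import Data.Fin using (zero; suc; punchIn; punchOut; toℕ; fromℕ<; _≟_)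
open import Data.Fin.Properties
  using (punchInᵢ≢i; punchIn-injective; punchIn-punchOut; punchOut-injective; punchOut-cong;
         punchOut-punchIn; suc-injective; toℕ-fromℕ<; toℕ-injective; toℕ<n; pigeonhole; any?)
  renaming (<⇒≢ to <⇒≢ᶠ)
open import Data.Empty using (⊥-elim)
open import Data.Sum using (_⊎_; inj₁; inj₂)
open import Data.Product using (∃; _×_; _,_; proj₁; proj₂)
open import Function using (_∘_)
open import Function.Definitions using (Injective)
open import Data.Vec.Functional using (updateAt)
open import Data.Vec.Functional.Properties using (updateAt-updates; updateAt-minimal)
open import Relation.Binary.PropositionalEquality as ≡ using (_≢_)
open import Relation.Nullary using (Dec; yes; no)
open import Relation.Binary.Bundles using (StrictPartialOrder)
open import Relation.Binary.Definitions using (tri<; tri≈; tri>)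
open import Relation.Binary.Structures using (IsStrictTotalOrder)
import Relation.Binary.Construct.StrictToNonStrict as StrictToNonStrict
import Relation.Binary.Reasoning.Setoid as SetoidReasoning
import Relation.Binary.Reasoning.StrictPartialOrder as OrderReasoning
import Algebra.Properties.Ring as RingProperties

-- On the basis columns π i the two solutions differ by
-- B⁻¹ γ, and off the basis both vanish, so ‖x̂ - x′‖² = Σ_i ((B⁻¹ γ)_i)².
-- By Cramer's rule every entry of B⁻¹ is (± a minor of B) · det B′, where
-- B′ is B with one row moved to the top; total unimodularity of A puts all
-- these minors in {-1, 0, 1}, and det B′ ≠ 0 since B is invertible, so B⁻¹
-- has entries in {-1, 0, 1}.  Hence |(B⁻¹ γ)_i| ≤ Σ_k |γ_k| < Γ, each square
-- is below Γ², and the m squares sum to less than m Γ².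

infixl 6 _[_]≔_
_[_]≔_ : ∀ {a} {A : Set a} {n} → (Fin n → A) → Fin n → A → Fin n → A
f [ r ]≔ x = updateAt f r (λ _ → x)

≔-hit : ∀ {a} {A : Set a} {n} (f : Fin n → A) r x → (f [ r ]≔ x) r ≡ x
≔-hit f r x = updateAt-updates r f

≔-miss : ∀ {a} {A : Set a} {n} (f : Fin n → A) {r} x {i} → i ≢ r → (f [ r ]≔ x) i ≡ f i
≔-miss f {r} x {i} i≢r = updateAt-minimal i r f i≢r

module OrderedFieldLinearAlgebra {c ℓ₁ ℓ₂ : Level} (F : OrderedField c ℓ₁ ℓ₂) where

  open OrderedField F hiding (zero)
  open Ops F
  open RingProperties ring
    using (-‿involutive; -‿+-comm; -‿distribˡ-*; -‿distribʳ-*; -0#≈0#; -1*x≈-x; x[y-z]≈xy-xz; [y-z]x≈yx-zx;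
           +-inverseʳ-unique)
  open SetoidReasoning setoid

  open import Algebra.Solver.Ring.NaturalCoefficients.Default commutativeSemiring
    using (solve; _:=_; _:+_; _:*_)

  Unimodular : Carrier → Set ℓ₁
  Unimodular x = (x ≈ - 1#) ⊎ (x ≈ 0#) ⊎ (x ≈ 1#)

  -- Finite sums

  Σ-cong : ∀ {n} {f g : Fin n → Carrier} → (∀ i → f i ≈ g i) → Σ f ≈ Σ g
  Σ-cong {zero}  f≈g = refl
  Σ-cong {suc n} f≈g = +-cong (f≈g zero) (Σ-cong (f≈g ∘ suc))

  Σ-zero : ∀ {n} {f : Fin n → Carrier} → (∀ i → f i ≈ 0#) → Σ f ≈ 0#
  Σ-zero {zero}  f≈0 = refl
  Σ-zero {suc n} f≈0 = trans (+-cong (f≈0 zero) (Σ-zero (f≈0 ∘ suc))) (+-identityˡ 0#)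

  Σ-+ : ∀ {n} (f g : Fin n → Carrier) → Σ (λ i → f i + g i) ≈ Σ f + Σ g
  Σ-+ {zero}  f g = sym (+-identityˡ 0#)
  Σ-+ {suc n} f g = begin
    (f zero + g zero) + Σ (λ i → f (suc i) + g (suc i)) ≈⟨ +-cong refl (Σ-+ (f ∘ suc) (g ∘ suc)) ⟩
    (f zero + g zero) + (Σ (f ∘ suc) + Σ (g ∘ suc))
      ≈⟨ solve 4 (λ a b x y → (a :+ b) :+ (x :+ y) := (a :+ x) :+ (b :+ y)) refl _ _ _ _ ⟩
    (f zero + Σ (f ∘ suc)) + (g zero + Σ (g ∘ suc)) ∎

  Σ-*ˡ : ∀ {n} a (f : Fin n → Carrier) → a * Σ f ≈ Σ (λ i → a * f i)
  Σ-*ˡ {zero}  a f = zeroʳ a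
  Σ-*ˡ {suc n} a f = trans (distribˡ a _ _) (+-cong refl (Σ-*ˡ a (f ∘ suc)))

  Σ-*ʳ : ∀ {n} a (f : Fin n → Carrier) → Σ f * a ≈ Σ (λ i → f i * a)
  Σ-*ʳ a f = trans (*-comm _ a) (trans (Σ-*ˡ a f) (Σ-cong (λ i → *-comm a (f i))))

  Σ-neg : ∀ {n} (f : Fin n → Carrier) → - Σ f ≈ Σ (λ i → - f i)
  Σ-neg {zero}  f = -0#≈0#
  Σ-neg {suc n} f = trans (sym (-‿+-comm _ _)) (+-cong refl (Σ-neg (f ∘ suc)))

  Σ-swap : ∀ {n m} (f : Fin n → Fin m → Carrier) →
           Σ (λ i → Σ (λ j → f i j)) ≈ Σ (λ j → Σ (λ i → f i j))
  Σ-swap {zero}  f = sym (Σ-zero {f = λ j → Σ (λ i → f i j)} (λ j → refl))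
  Σ-swap {suc n} f = trans (+-cong refl (Σ-swap (f ∘ suc))) (sym (Σ-+ (f zero) _))

  Σ-const : ∀ n a → Σ {n} (λ _ → a) ≈ fromℕ n * a
  Σ-const zero    a = sym (zeroˡ a)
  Σ-const (suc n) a = begin
    a + Σ {n} (λ _ → a)      ≈⟨ +-cong (sym (*-identityˡ a)) (Σ-const n a) ⟩
    1# * a + fromℕ n * a     ≈⟨ sym (distribʳ a 1# (fromℕ n)) ⟩
    (1# + fromℕ n) * a       ∎

  Σ-extract : ∀ {n} (f : Fin (suc n) → Carrier) i → Σ f ≈ f i + Σ (f ∘ punchIn i)
  Σ-extract f zero = refl
  Σ-extract {suc n} f (suc i) = begin
    f zero + Σ (f ∘ suc)                                 ≈⟨ +-cong refl (Σ-extract (f ∘ suc) i) ⟩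
    f zero + (f (suc i) + Σ (f ∘ suc ∘ punchIn i))
      ≈⟨ solve 3 (λ a b x → a :+ (b :+ x) := b :+ (a :+ x)) refl _ _ _ ⟩
    f (suc i) + (f zero + Σ (f ∘ suc ∘ punchIn i))       ∎

  Σ-single : ∀ {n} (f : Fin n → Carrier) l → (∀ k → k ≢ l → f k ≈ 0#) → Σ f ≈ f l
  Σ-single {suc n} f l f≈0 = begin
    Σ f                        ≈⟨ Σ-extract f l ⟩
    f l + Σ (f ∘ punchIn l)    ≈⟨ +-cong refl (Σ-zero (λ k → f≈0 _ (punchInᵢ≢i l k))) ⟩
    f l + 0#                   ≈⟨ +-identityʳ _ ⟩
    f l                        ∎

  Σ-identity : ∀ {n} (t : Fin n) (f : Fin n → Carrier) → Σ (λ j → I t j * f j) ≈ f t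
  Σ-identity {suc n} zero f = begin
    1# * f zero + Σ (λ j → 0# * f (suc j)) ≈⟨ +-cong (*-identityˡ _) (Σ-zero {f = λ j → 0# * f (suc j)} (λ j → zeroˡ _)) ⟩
    f zero + 0#                            ≈⟨ +-identityʳ _ ⟩
    f zero                                 ∎
  Σ-identity {suc n} (suc t) f = begin
    0# * f zero + Σ (λ j → I t j * f (suc j)) ≈⟨ +-cong (zeroˡ _) (Σ-identity t (f ∘ suc)) ⟩
    0# + f (suc t)                            ≈⟨ +-identityˡ _ ⟩
    f (suc t)                                 ∎

  -- Induction on m: split off
  -- the summand at π zero and re-index the rest through punchOut.
  Σ-image : ∀ {m N} (π : Fin m → Fin N) → Injective _≡_ _≡_ π → (g : Fin N → Carrier) →
            (∀ j → (∀ i → ¬ (π i ≡ j)) → g j ≈ 0#) → Σ g ≈ Σ (g ∘ π)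
  Σ-image {zero} π π-inj g outside = Σ-zero (λ j → outside j (λ ()))
  Σ-image {suc m} {zero} π π-inj g outside with π zero
  ... | ()
  Σ-image {suc m} {suc N} π π-inj g outside = begin
    Σ g                               ≈⟨ Σ-extract g p ⟩
    g p + Σ (g ∘ punchIn p)           ≈⟨ +-cong refl (Σ-image π′ π′-inj (g ∘ punchIn p) outside′) ⟩
    g p + Σ (g ∘ punchIn p ∘ π′)      ≈⟨ +-cong refl (Σ-cong (λ i → reflexive (≡.cong g (punchIn-punchOut (away i))))) ⟩
    g p + Σ (g ∘ π ∘ suc)             ∎
    where
    p = π zero
    away : ∀ i → p ≢ π (suc i)
    away i e with π-inj e
    ... | ()
    π′ : Fin m → Fin N
    π′ i = punchOut (away i)
    π′-inj : Injective _≡_ _≡_ π′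
    π′-inj {i} {j} e = suc-injective (π-inj (punchOut-injective (away i) (away j) e))
    outside′ : ∀ k → (∀ i → ¬ (π′ i ≡ k)) → g (punchIn p k) ≈ 0#
    outside′ k not-hit = outside (punchIn p k) hit
      where
      hit : ∀ i → ¬ (π i ≡ punchIn p k)
      hit zero    e = punchInᵢ≢i p k (≡.sym e)
      hit (suc i) e = not-hit i (punchIn-injective p _ k (≡.trans (punchIn-punchOut (away i)) e))

  -- Order: the non-strict order x ≼ y = x < y ⊎ x ≈ y and its interaction
  -- with +, negation, multiplication and absolute value

  open IsStrictTotalOrder isStrictTotalOrder
    using (irrefl; asym; isStrictPartialOrder; <-respʳ-≈; <-respˡ-≈) renaming (trans to <-trans)
  open StrictToNonStrict _≈_ _<_ using (<⇒≤) renaming (_≤_ to _≼_; reflexive to ≈⇒≼)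

  strictPartialOrder : StrictPartialOrder c ℓ₁ ℓ₂
  strictPartialOrder = record { isStrictPartialOrder = isStrictPartialOrder }

  <-≼-trans : ∀ {x y z} → x < y → y ≼ z → x < z
  <-≼-trans = StrictToNonStrict.<-≤-trans _≈_ _<_ <-trans <-respʳ-≈

  ≼-<-trans : ∀ {x y z} → x ≼ y → y < z → x < z
  ≼-<-trans = StrictToNonStrict.≤-<-trans _≈_ _<_ sym <-trans <-respˡ-≈

  ≼-respʳ-≈ : ∀ {x y z} → y ≈ z → x ≼ y → x ≼ z
  ≼-respʳ-≈ = StrictToNonStrict.≤-respʳ-≈ _≈_ _<_ trans <-respʳ-≈

  ≼-respˡ-≈ : ∀ {x y z} → x ≈ y → x ≼ z → y ≼ z
  ≼-respˡ-≈ = StrictToNonStrict.≤-respˡ-≈ _≈_ _<_ sym trans <-respˡ-≈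

  +-monoˡ-< : ∀ {x y} z → x < y → (z + x) < (z + y)
  +-monoˡ-< {x} {y} z x<y = <-respˡ-≈ (+-comm x z) (<-respʳ-≈ (+-comm y z) (+-mono-< z x<y))

  +-mono-<-≼ : ∀ {a b x y} → a < b → x ≼ y → (a + x) < (b + y)
  +-mono-<-≼ {a} {b} {x} a<b (inj₁ x<y) = <-trans (+-mono-< x a<b) (+-monoˡ-< b x<y)
  +-mono-<-≼ {a} {b} {x} a<b (inj₂ x≈y) = <-respʳ-≈ (+-cong refl x≈y) (+-mono-< x a<b)

  +-mono-≼ : ∀ {a b x y} → a ≼ b → x ≼ y → a + x ≼ b + y
  +-mono-≼ (inj₁ a<b) x≼y = <⇒≤ (+-mono-<-≼ a<b x≼y)
  +-mono-≼ {b = b} (inj₂ a≈b) (inj₁ x<y) = inj₁ (<-respˡ-≈ (+-cong (sym a≈b) refl) (+-monoˡ-< b x<y))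
  +-mono-≼ (inj₂ a≈b) (inj₂ x≈y) = inj₂ (+-cong a≈b x≈y)

  Σ-mono-≼ : ∀ {n} {f g : Fin n → Carrier} → (∀ i → f i ≼ g i) → Σ f ≼ Σ g
  Σ-mono-≼ {zero}  f≼g = ≈⇒≼ refl
  Σ-mono-≼ {suc n} f≼g = +-mono-≼ (f≼g zero) (Σ-mono-≼ (f≼g ∘ suc))

  -- Strict monotonicity needs a nonempty index set.
  Σ-mono-< : ∀ {n} {f g : Fin (suc n) → Carrier} → (∀ i → f i < g i) → Σ f < Σ g
  Σ-mono-< f<g = +-mono-<-≼ (f<g zero) (Σ-mono-≼ (<⇒≤ ∘ f<g ∘ suc))

  <⇒0<- : ∀ {x y} → x < y → 0# < (y - x)
  <⇒0<- {x} x<y = <-respˡ-≈ (-‿inverseʳ x) (+-mono-< (- x) x<y)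

  0<-⇒< : ∀ {x y} → 0# < (y - x) → x < y
  0<-⇒< {x} {y} 0<y-x = <-respˡ-≈ (+-identityˡ x) (<-respʳ-≈ y-x+x≈y (+-mono-< x 0<y-x))
    where
    y-x+x≈y : (y - x) + x ≈ y
    y-x+x≈y = trans (+-assoc y (- x) x) (trans (+-cong refl (-‿inverseˡ x)) (+-identityʳ y))

  neg-antitone-< : ∀ {x y} → x < y → (- y) < (- x)
  neg-antitone-< {x} {y} x<y = 0<-⇒< (<-respʳ-≈ rearrange (<⇒0<- x<y))
    where
    rearrange : y - x ≈ - x - (- y)
    rearrange = trans (+-comm y (- x)) (+-cong refl (sym (-‿involutive y)))

  neg-antitone-≼ : ∀ {x y} → x ≼ y → - y ≼ - x
  neg-antitone-≼ (inj₁ x<y) = inj₁ (neg-antitone-< x<y)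
  neg-antitone-≼ (inj₂ x≈y) = inj₂ (-‿cong (sym x≈y))

  neg-pos : ∀ {x} → x < 0# → 0# < (- x)
  neg-pos x<0 = <-respˡ-≈ -0#≈0# (neg-antitone-< x<0)

  pos-neg : ∀ {x} → 0# < x → (- x) < 0#
  pos-neg 0<x = <-respʳ-≈ -0#≈0# (neg-antitone-< 0<x)

  -- Any positive element forces 1 to be positive (squares are never negative).
  0<1 : ∀ {x} → 0# < x → 0# < 1#
  0<1 {x} 0<x with compare 1# 0#
  ... | tri< 1<0 _ _ = ⊥-elim (asym 1<0 (<-respʳ-≈ (-1*-1≈1) (*-pos (neg-pos 1<0) (neg-pos 1<0))))
    where
    -1*-1≈1 : - 1# * - 1# ≈ 1#
    -1*-1≈1 = trans (sym (-‿distribˡ-* 1# (- 1#))) (trans (-‿cong (*-identityˡ _)) (-‿involutive 1#))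
  ... | tri≈ _ 1≈0 _ = ⊥-elim (irrefl refl (<-respʳ-≈ x≈0 0<x))
    where
    x≈0 : x ≈ 0#
    x≈0 = trans (sym (*-identityˡ x)) (trans (*-cong 1≈0 refl) (zeroˡ x))
  ... | tri> _ _ 0<1 = 0<1

  fromℕ-nonneg : ∀ {x} → 0# < x → ∀ n → 0# ≼ fromℕ n
  fromℕ-nonneg 0<x zero    = ≈⇒≼ refl
  fromℕ-nonneg 0<x (suc n) = <⇒≤ (<-respˡ-≈ (+-identityˡ 0#) (+-mono-<-≼ (0<1 0<x) (fromℕ-nonneg 0<x n)))

  fromℕ-pos : ∀ {x} → 0# < x → ∀ n → 0# < fromℕ (suc n)
  fromℕ-pos 0<x n = <-respˡ-≈ (+-identityˡ 0#) (+-mono-<-≼ (0<1 0<x) (fromℕ-nonneg 0<x n))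

  *-monoˡ-< : ∀ {a x y} → 0# < a → x < y → (a * x) < (a * y)
  *-monoˡ-< {a} {x} {y} 0<a x<y = 0<-⇒< (<-respʳ-≈ distribute (*-pos 0<a (<⇒0<- x<y)))
    where
    distribute : a * (y - x) ≈ a * y - a * x
    distribute = x[y-z]≈xy-xz a y x

  *-cancelˡ-< : ∀ {a x y} → 0# < a → (a * x) < (a * y) → x < y
  *-cancelˡ-< {a} {x} {y} 0<a ax<ay with compare x y
  ... | tri< x<y _ _ = x<y
  ... | tri≈ _ x≈y _ = ⊥-elim (irrefl (*-cong refl x≈y) ax<ay)
  ... | tri> _ _ y<x = ⊥-elim (asym ax<ay (*-monoˡ-< 0<a y<x))

  square-< : ∀ {G e} → (- G) < e → e < G → (e * e) < (G * G)
  square-< {G} {e} -G<e e<G = 0<-⇒< (<-respʳ-≈ difference-of-squares (*-pos (<⇒0<- e<G) 0<e+G))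
    where
    0<e+G : 0# < (e + G)
    0<e+G = <-respʳ-≈ (+-cong refl (-‿involutive G)) (<⇒0<- -G<e)
    difference-of-squares : (G - e) * (e + G) ≈ G * G - e * e
    difference-of-squares = begin
      (G - e) * (e + G)                     ≈⟨ [y-z]x≈yx-zx (e + G) G e ⟩
      G * (e + G) - e * (e + G)             ≈⟨ +-cong (distribˡ G e G) (-‿cong (distribˡ e e G)) ⟩
      (G * e + G * G) - (e * e + e * G)     ≈⟨ +-cong (+-comm _ _) (-‿cong (+-comm _ _)) ⟩
      (G * G + G * e) - (e * G + e * e)     ≈⟨ +-cong (+-cong refl (*-comm G e)) (sym (-‿+-comm _ _)) ⟩
      (G * G + e * G) + (- (e * G) - e * e) ≈⟨ +-assoc _ _ _ ⟩
      G * G + (e * G + (- (e * G) - e * e)) ≈⟨ +-cong refl (sym (+-assoc _ _ _)) ⟩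
      G * G + ((e * G - e * G) - e * e)     ≈⟨ +-cong refl (+-cong (-‿inverseʳ _) refl) ⟩
      G * G + (0# - e * e)                  ≈⟨ +-cong refl (+-identityˡ _) ⟩
      G * G - e * e                         ∎

  ≼-abs : ∀ x → x ≼ ∣ x ∣
  ≼-abs x with compare x 0#
  ... | tri< x<0 _ _ = inj₁ (<-trans x<0 (neg-pos x<0))
  ... | tri≈ _ _ _   = ≈⇒≼ refl
  ... | tri> _ _ _   = ≈⇒≼ refl

  -abs-≼ : ∀ x → (- ∣ x ∣) ≼ x
  -abs-≼ x with compare x 0#
  ... | tri< _ _ _   = ≈⇒≼ (-‿involutive x)
  ... | tri≈ _ x≈0 _ = ≈⇒≼ (trans (-‿cong x≈0) (trans -0#≈0# (sym x≈0)))
  ... | tri> _ _ 0<x = inj₁ (<-trans (pos-neg 0<x) 0<x)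

  abs-nonneg : ∀ x → 0# ≼ ∣ x ∣
  abs-nonneg x with compare x 0#
  ... | tri< x<0 _ _ = inj₁ (neg-pos x<0)
  ... | tri≈ _ x≈0 _ = ≈⇒≼ (sym x≈0)
  ... | tri> _ _ 0<x = inj₁ 0<x

  unimodular-scale : ∀ {β} x → Unimodular β → ((- ∣ x ∣) ≼ β * x) × (β * x ≼ ∣ x ∣)
  unimodular-scale {β} x (inj₁ β≈-1) =
    ≼-respʳ-≈ (sym βx≈-x) (neg-antitone-≼ (≼-abs x)) ,
    ≼-respˡ-≈ (sym βx≈-x) (≼-respʳ-≈ (-‿involutive _) (neg-antitone-≼ (-abs-≼ x)))
    where
    βx≈-x : β * x ≈ - x
    βx≈-x = trans (*-cong β≈-1 refl) (-1*x≈-x x)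
  unimodular-scale {β} x (inj₂ (inj₁ β≈0)) =
    ≼-respʳ-≈ (sym βx≈0) (≼-respʳ-≈ -0#≈0# (neg-antitone-≼ (abs-nonneg x))) ,
    ≼-respˡ-≈ (sym βx≈0) (abs-nonneg x)
    where
    βx≈0 : β * x ≈ 0#
    βx≈0 = trans (*-cong β≈0 refl) (zeroˡ x)
  unimodular-scale {β} x (inj₂ (inj₂ β≈1)) =
    ≼-respʳ-≈ (sym βx≈x) (-abs-≼ x) , ≼-respˡ-≈ (sym βx≈x) (≼-abs x)
    where
    βx≈x : β * x ≈ x
    βx≈x = trans (*-cong β≈1 refl) (*-identityˡ x)

  sign : ∀ {n} → Fin n → Carrier
  sign j = sgn (toℕ j)

  minor : ∀ {n} → Matrix (suc n) (suc n) → Fin (suc n) → Matrix n n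
  minor M j i k = M (suc i) (punchIn j k)

  expansion-term : ∀ {n} → Matrix (suc n) (suc n) → Fin (suc n) → Carrier
  expansion-term M j = sign j * (M zero j * det (minor M j))

  det-cong : ∀ {n} {M M′ : Matrix n n} → M ≈ₘ M′ → det M ≈ det M′
  det-cong {zero} M≈M′ = refl
  det-cong {suc n} {M} {M′} M≈M′ = Σ-cong {f = expansion-term M} {g = expansion-term M′} (λ j →
    *-cong refl (*-cong (M≈M′ zero j) (det-cong (λ i k → M≈M′ (suc i) (punchIn j k)))))

  neg*neg : ∀ a b → (- a) * (- b) ≈ a * b
  neg*neg a b = trans (sym (-‿distribˡ-* a (- b))) (trans (-‿cong (sym (-‿distribʳ-* a b))) (-‿involutive _))

  -- Deleting columns j and j′ from a row, in either order, leaves the same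
  -- columns; the two orders differ by exactly one sign.
  punchIn-twice : ∀ {n} (j j′ : Fin (suc (suc n))) (j≢j′ : j ≢ j′) (j′≢j : j′ ≢ j) (l : Fin n) →
    punchIn j (punchIn (punchOut j≢j′) l) ≡ punchIn j′ (punchIn (punchOut j′≢j) l)
  punchIn-twice zero    zero    j≢j′ _ l = ⊥-elim (j≢j′ ≡.refl)
  punchIn-twice zero    (suc b) _    _ l = ≡.refl
  punchIn-twice (suc a) zero    _    _ l = ≡.refl
  punchIn-twice (suc a) (suc b) _    _ zero = ≡.refl
  punchIn-twice {suc n} (suc a) (suc b) j≢j′ j′≢j (suc l) =
    ≡.cong suc (punchIn-twice a b (j≢j′ ∘ ≡.cong suc) (j′≢j ∘ ≡.cong suc) l)

  sign-twice : ∀ {n} (j j′ : Fin (suc (suc n))) (j≢j′ : j ≢ j′) (j′≢j : j′ ≢ j) →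
    sign j * sign (punchOut j≢j′) ≈ - (sign j′ * sign (punchOut j′≢j))
  sign-twice zero zero j≢j′ _ = ⊥-elim (j≢j′ ≡.refl)
  sign-twice zero (suc b) _ _ = begin
    1# * sign b            ≈⟨ *-identityˡ _ ⟩
    sign b                 ≈⟨ sym (-‿involutive _) ⟩
    - - sign b             ≈⟨ -‿cong (sym (*-identityʳ _)) ⟩
    - ((- sign b) * 1#)    ∎
  sign-twice (suc a) zero _ _ = trans (*-identityʳ _) (-‿cong (sym (*-identityˡ _)))
  sign-twice {zero} (suc zero) (suc zero) j≢j′ _ = ⊥-elim (j≢j′ ≡.refl)
  sign-twice {suc n} (suc a) (suc b) j≢j′ j′≢j = begin
    (- sign a) * (- sign (punchOut (j≢j′ ∘ ≡.cong suc)))  ≈⟨ neg*neg _ _ ⟩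
    sign a * sign (punchOut (j≢j′ ∘ ≡.cong suc))          ≈⟨ sign-twice a b _ _ ⟩
    - (sign b * sign (punchOut (j′≢j ∘ ≡.cong suc)))      ≈⟨ -‿cong (sym (neg*neg _ _)) ⟩
    - ((- sign b) * (- sign (punchOut (j′≢j ∘ ≡.cong suc)))) ∎

  module TwoRowExpansion {n : ℕ} (a b : Fin (suc (suc n)) → Carrier)
                         (R : Fin n → Fin (suc (suc n)) → Carrier) where

    stack : Matrix (suc (suc n)) (suc (suc n))
    stack zero          = a
    stack (suc zero)    = b
    stack (suc (suc i)) = R i

    minor₂ : Fin (suc (suc n)) → Fin (suc n) → Carrier
    minor₂ j k = det (λ i l → R i (punchIn j (punchIn k l)))

    term′ : (j j′ : Fin (suc (suc n))) → Dec (j ≡ j′) → Carrier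
    term′ j j′ (yes _)   = 0#
    term′ j j′ (no j≢j′) = (sign j * sign (punchOut j≢j′)) * (a j * (b j′ * minor₂ j (punchOut j≢j′)))

    term : Fin (suc (suc n)) → Fin (suc (suc n)) → Carrier
    term j j′ = term′ j j′ (j ≟ j′)

    term-diagonal : ∀ j d → term′ j j d ≈ 0#
    term-diagonal j (yes _)   = refl
    term-diagonal j (no j≢j) = ⊥-elim (j≢j ≡.refl)

    term-punchIn : ∀ j k d → term′ j (punchIn j k) d ≈ (sign j * sign k) * (a j * (b (punchIn j k) * minor₂ j k))
    term-punchIn j k (yes e) = ⊥-elim (punchInᵢ≢i j k (≡.sym e))
    term-punchIn j k (no _)  = reflexive (≡.cong (λ k′ → (sign j * sign k′) * (a j * (b (punchIn j k) * minor₂ j k′)))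
                                            (≡.trans (punchOut-cong j ≡.refl) (punchOut-punchIn j)))

    expansion : det stack ≈ Σ (λ j → Σ (λ j′ → term j j′))
    expansion = Σ-cong row
      where
      row : ∀ j → sign j * (a j * Σ (λ k → sign k * (b (punchIn j k) * minor₂ j k))) ≈ Σ (term j)
      row j = begin
        sign j * (a j * Σ (λ k → sign k * (b (punchIn j k) * minor₂ j k)))
          ≈⟨ *-cong refl (Σ-*ˡ (a j) (λ k → sign k * (b (punchIn j k) * minor₂ j k))) ⟩
        sign j * Σ (λ k → a j * (sign k * (b (punchIn j k) * minor₂ j k)))
          ≈⟨ Σ-*ˡ (sign j) (λ k → a j * (sign k * (b (punchIn j k) * minor₂ j k))) ⟩
        Σ (λ k → sign j * (a j * (sign k * (b (punchIn j k) * minor₂ j k))))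
          ≈⟨ Σ-cong (λ k → solve 5 (λ x y z u v → x :* (y :* (z :* (u :* v))) := (x :* z) :* (y :* (u :* v))) refl
                                   (sign j) (a j) (sign k) (b (punchIn j k)) (minor₂ j k)) ⟩
        Σ (λ k → (sign j * sign k) * (a j * (b (punchIn j k) * minor₂ j k)))
          ≈⟨ Σ-cong (λ k → sym (term-punchIn j k (j ≟ punchIn j k))) ⟩
        Σ (term j ∘ punchIn j)            ≈⟨ sym (+-identityˡ _) ⟩
        0# + Σ (term j ∘ punchIn j)       ≈⟨ +-cong (sym (term-diagonal j (j ≟ j))) refl ⟩
        term j j + Σ (term j ∘ punchIn j) ≈⟨ sym (Σ-extract (term j) j) ⟩
        Σ (term j)                        ∎

  term-antisymmetric : ∀ {n} a b R (j j′ : Fin (suc (suc n))) d d′ →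
    TwoRowExpansion.term′ b a R j j′ d ≈ - TwoRowExpansion.term′ a b R j′ j d′
  term-antisymmetric a b R j j′ (yes _)    (yes _)    = sym -0#≈0#
  term-antisymmetric a b R j j′ (yes e)    (no j′≢j) = ⊥-elim (j′≢j (≡.sym e))
  term-antisymmetric a b R j j′ (no j≢j′) (yes e)    = ⊥-elim (j≢j′ (≡.sym e))
  term-antisymmetric a b R j j′ (no j≢j′) (no j′≢j) = begin
    (sign j * sign (punchOut j≢j′)) * (b j * (a j′ * D))
      ≈⟨ *-cong (sign-twice j j′ j≢j′ j′≢j) (*-cong refl (*-cong refl D≈D′)) ⟩
    (- (sign j′ * sign (punchOut j′≢j))) * (b j * (a j′ * D′))
      ≈⟨ sym (-‿distribˡ-* _ _) ⟩
    - ((sign j′ * sign (punchOut j′≢j)) * (b j * (a j′ * D′)))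
      ≈⟨ -‿cong (*-cong refl (solve 3 (λ x y z → x :* (y :* z) := y :* (x :* z)) refl (b j) (a j′) D′)) ⟩
    - ((sign j′ * sign (punchOut j′≢j)) * (a j′ * (b j * D′))) ∎
    where
    D  = TwoRowExpansion.minor₂ b a R j (punchOut j≢j′)
    D′ = TwoRowExpansion.minor₂ a b R j′ (punchOut j′≢j)
    D≈D′ : D ≈ D′
    D≈D′ = det-cong (λ i l → reflexive (≡.cong (R i) (punchIn-twice j j′ j≢j′ j′≢j l)))

  det-swap₀₁ : ∀ {n} (M M′ : Matrix (suc (suc n)) (suc (suc n))) →
    (∀ j → M′ zero j ≈ M (suc zero) j) → (∀ j → M′ (suc zero) j ≈ M zero j) →
    (∀ i j → M′ (suc (suc i)) j ≈ M (suc (suc i)) j) → det M′ ≈ - det M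
  det-swap₀₁ {n} M M′ M′₀ M′₁ M′ᵢ = begin
    det M′                                         ≈⟨ det-cong M′≈stack ⟩
    det (stack b a R)                              ≈⟨ expansion b a R ⟩
    Σ (λ j → Σ (λ j′ → term b a R j j′))
      ≈⟨ Σ-cong (λ j → Σ-cong (λ j′ → term-antisymmetric a b R j j′ (j ≟ j′) (j′ ≟ j))) ⟩
    Σ (λ j → Σ (λ j′ → - term a b R j′ j))         ≈⟨ Σ-cong (λ j → sym (Σ-neg (λ j′ → term a b R j′ j))) ⟩
    Σ (λ j → - Σ (λ j′ → term a b R j′ j))         ≈⟨ sym (Σ-neg (λ j → Σ (λ j′ → term a b R j′ j))) ⟩
    - Σ (λ j → Σ (λ j′ → term a b R j′ j))         ≈⟨ -‿cong (sym (Σ-swap (term a b R))) ⟩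
    - Σ (λ j′ → Σ (λ j → term a b R j′ j))         ≈⟨ -‿cong (sym (expansion a b R)) ⟩
    - det (stack a b R)                            ≈⟨ -‿cong (sym (det-cong M≈stack)) ⟩
    - det M                                        ∎
    where
    open TwoRowExpansion using (stack; term; expansion)
    a = M zero
    b = M (suc zero)
    R = λ i → M (suc (suc i))
    M≈stack : M ≈ₘ stack a b R
    M≈stack zero          j = refl
    M≈stack (suc zero)    j = refl
    M≈stack (suc (suc i)) j = refl
    M′≈stack : M′ ≈ₘ stack b a R
    M′≈stack zero          j = M′₀ j
    M′≈stack (suc zero)    j = M′₁ j
    M′≈stack (suc (suc i)) j = M′ᵢ i j

  -- Rows p, q > 0 are handled
  -- by induction through the first-row expansion; row 0 = row q reduces to
  -- row 1 = row q by swapping rows 0 and 1, and to x ≈ - x at q = 1.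
  x≈-x⇒x≈0 : ∀ {x} → x ≈ - x → x ≈ 0#
  x≈-x⇒x≈0 {x} x≈-x with compare x 0#
  ... | tri< x<0 _ _ = ⊥-elim (asym x<0 (<-respʳ-≈ (sym x≈-x) (neg-pos x<0)))
  ... | tri≈ _ x≈0 _ = x≈0
  ... | tri> _ _ 0<x = ⊥-elim (asym 0<x (<-respˡ-≈ (sym x≈-x) (pos-neg 0<x)))

  mutual
    det-equal-rows : ∀ {n} (M : Matrix n n) {p q} → p ≢ q → (∀ j → M p j ≈ M q j) → det M ≈ 0#
    det-equal-rows M {zero}  {zero}  p≢q Mp≈Mq = ⊥-elim (p≢q ≡.refl)
    det-equal-rows M {zero}  {suc q} p≢q Mp≈Mq = det-equal-rows₀ M q Mp≈Mq
    det-equal-rows M {suc p} {zero}  p≢q Mp≈Mq = det-equal-rows₀ M p (sym ∘ Mp≈Mq)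
    det-equal-rows M {suc p} {suc q} p≢q Mp≈Mq = det-equal-rowsₛ M (p≢q ∘ ≡.cong suc) Mp≈Mq

    det-equal-rowsₛ : ∀ {n} (M : Matrix (suc n) (suc n)) {p q} → p ≢ q →
                      (∀ j → M (suc p) j ≈ M (suc q) j) → det M ≈ 0#
    det-equal-rowsₛ M p≢q Mp≈Mq = Σ-zero (λ j → zero-minor j (det-equal-rows (minor M j) p≢q (Mp≈Mq ∘ punchIn j)))
      where
      zero-minor : ∀ j → det (minor M j) ≈ 0# → sign j * (M zero j * det (minor M j)) ≈ 0#
      zero-minor j d≈0 = trans (*-cong refl (trans (*-cong refl d≈0) (zeroʳ _))) (zeroʳ _)

    det-equal-rows₀ : ∀ {n} (M : Matrix (suc n) (suc n)) q → (∀ j → M zero j ≈ M (suc q) j) → det M ≈ 0#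
    det-equal-rows₀ {suc n} M zero    M₀≈M₁ = x≈-x⇒x≈0 (det-swap₀₁ M M M₀≈M₁ (sym ∘ M₀≈M₁) (λ i j → refl))
    det-equal-rows₀ {suc n} M (suc q) M₀≈Mq = begin
      det M      ≈⟨ sym (-‿involutive _) ⟩
      - - det M  ≈⟨ -‿cong (sym (det-swap₀₁ M M′ (λ j → refl) (λ j → refl) (λ i j → refl))) ⟩
      - det M′   ≈⟨ -‿cong (det-equal-rowsₛ M′ {zero} {suc q} (λ ()) M₀≈Mq) ⟩
      - 0#       ≈⟨ -0#≈0# ⟩
      0#         ∎
      where
      M′ = TwoRowExpansion.stack (M (suc zero)) (M zero) (λ i → M (suc (suc i)))

  det-regroup : ∀ {n K} (M : Matrix (suc n) (suc n)) (c : Fin K → Carrier) (Ms : Fin K → Matrix (suc n) (suc n)) →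
    (∀ j → expansion-term M j ≈ Σ (λ k → c k * expansion-term (Ms k) j)) →
    det M ≈ Σ (λ k → c k * det (Ms k))
  det-regroup M c Ms column = begin
    Σ (expansion-term M)                                  ≈⟨ Σ-cong column ⟩
    Σ (λ j → Σ (λ k → c k * expansion-term (Ms k) j))     ≈⟨ Σ-swap (λ j k → c k * expansion-term (Ms k) j) ⟩
    Σ (λ k → Σ (λ j → c k * expansion-term (Ms k) j))     ≈⟨ Σ-cong (λ k → sym (Σ-*ˡ (c k) (expansion-term (Ms k)))) ⟩
    Σ (λ k → c k * det (Ms k))                            ∎

  -- For r = 0 the minors of M and Ms k agree; otherwise row r lies inside
  -- every minor and induction applies.
  det-linear-row : ∀ {n K} (M : Matrix n n) (r : Fin n) (c : Fin K → Carrier) (Ms : Fin K → Matrix n n) →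
    (∀ k i → i ≢ r → ∀ j → Ms k i j ≈ M i j) →
    (∀ j → M r j ≈ Σ (λ k → c k * Ms k r j)) →
    det M ≈ Σ (λ k → c k * det (Ms k))
  det-linear-row {suc n} M zero c Ms off-r row-r = det-regroup M c Ms column
    where
    column : ∀ j → expansion-term M j ≈ Σ (λ k → c k * expansion-term (Ms k) j)
    column j = begin
      sign j * (M zero j * D)                         ≈⟨ *-cong refl (*-cong (row-r j) refl) ⟩
      sign j * (Σ (λ k → c k * Ms k zero j) * D)      ≈⟨ *-cong refl (Σ-*ʳ D (λ k → c k * Ms k zero j)) ⟩
      sign j * Σ (λ k → (c k * Ms k zero j) * D)      ≈⟨ Σ-*ˡ (sign j) (λ k → (c k * Ms k zero j) * D) ⟩
      Σ (λ k → sign j * ((c k * Ms k zero j) * D))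
        ≈⟨ Σ-cong (λ k → trans (solve 4 (λ S C X E → S :* ((C :* X) :* E) := C :* (S :* (X :* E))) refl
                                         (sign j) (c k) (Ms k zero j) D)
                               (*-cong refl (*-cong refl (*-cong refl (minors-agree k))))) ⟩
      Σ (λ k → c k * expansion-term (Ms k) j)         ∎
      where
      D = det (minor M j)
      minors-agree : ∀ k → D ≈ det (minor (Ms k) j)
      minors-agree k = det-cong (λ i l → sym (off-r k (suc i) (λ ()) (punchIn j l)))
  det-linear-row {suc n} M (suc r) c Ms off-r row-r = det-regroup M c Ms column
    where
    column : ∀ j → expansion-term M j ≈ Σ (λ k → c k * expansion-term (Ms k) j)
    column j = begin
      sign j * (M zero j * det (minor M j))            ≈⟨ *-cong refl (*-cong refl minor-linear) ⟩
      sign j * (M zero j * Σ (λ k → c k * D k))        ≈⟨ *-cong refl (Σ-*ˡ (M zero j) (λ k → c k * D k)) ⟩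
      sign j * Σ (λ k → M zero j * (c k * D k))        ≈⟨ Σ-*ˡ (sign j) (λ k → M zero j * (c k * D k)) ⟩
      Σ (λ k → sign j * (M zero j * (c k * D k)))
        ≈⟨ Σ-cong (λ k → trans (solve 4 (λ S X C E → S :* (X :* (C :* E)) := C :* (S :* (X :* E))) refl
                                         (sign j) (M zero j) (c k) (D k))
                               (*-cong refl (*-cong refl (*-cong (sym (off-r k zero (λ ()) j)) refl)))) ⟩
      Σ (λ k → c k * expansion-term (Ms k) j)          ∎
      where
      D : _ → Carrier
      D k = det (minor (Ms k) j)
      minor-linear : det (minor M j) ≈ Σ (λ k → c k * D k)
      minor-linear = det-linear-row (minor M j) r c (λ k → minor (Ms k) j)
        (λ k i i≢r l → off-r k (suc i) (i≢r ∘ suc-injective) (punchIn j l)) (row-r ∘ punchIn j)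

  det-+-row : ∀ {n} (M M₁ M₂ : Matrix n n) (r : Fin n) →
    (∀ i → i ≢ r → ∀ j → M₁ i j ≈ M i j) → (∀ i → i ≢ r → ∀ j → M₂ i j ≈ M i j) →
    (∀ j → M r j ≈ M₁ r j + M₂ r j) → det M ≈ det M₁ + det M₂
  det-+-row {n} M M₁ M₂ r off₁ off₂ row-r = begin
    det M                                  ≈⟨ det-linear-row M r (λ _ → 1#) Ms off row ⟩
    1# * det M₁ + (1# * det M₂ + 0#)       ≈⟨ one-one ⟩
    det M₁ + det M₂                        ∎
    where
    Ms : Fin 2 → Matrix n n
    Ms zero    = M₁
    Ms (suc _) = M₂
    off : ∀ k i → i ≢ r → ∀ j → Ms k i j ≈ M i j
    off zero       = off₁
    off (suc zero) = off₂
    one-one : ∀ {x y} → 1# * x + (1# * y + 0#) ≈ x + y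
    one-one = +-cong (*-identityˡ _) (trans (+-identityʳ _) (*-identityˡ _))
    row : ∀ j → M r j ≈ 1# * M₁ r j + (1# * M₂ r j + 0#)
    row j = trans (row-r j) (sym one-one)

  -- Writing M⟨ x , y ⟩ for M with rows p, q
  -- replaced by x, y, expand 0 = det M⟨ Mp + Mq , Mp + Mq ⟩ by additivity in
  -- both rows; the terms with equal rows vanish and det M + det M′ remains.
  det-swap-rows : ∀ {n} (M M′ : Matrix n n) {p q} → p ≢ q →
    (∀ j → M′ p j ≈ M q j) → (∀ j → M′ q j ≈ M p j) →
    (∀ i → i ≢ p → i ≢ q → ∀ j → M′ i j ≈ M i j) → det M′ ≈ - det M
  det-swap-rows {n} M M′ {p} {q} p≢q M′p M′q M′i = +-inverseʳ-unique (det M) (det M′) (begin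
    det M + det M′                                        ≈⟨ sym (+-cong (+-identityˡ _) (+-identityʳ _)) ⟩
    (0# + det M) + (det M′ + 0#)
      ≈⟨ sym (+-cong (+-cong (equal Mp) (det-cong unchanged)) (+-cong (det-cong swapped) (equal Mq))) ⟩
    (det M⟨ Mp , Mp ⟩ + det M⟨ Mp , Mq ⟩) + (det M⟨ Mq , Mp ⟩ + det M⟨ Mq , Mq ⟩)
      ≈⟨ sym (+-cong (additive-q Mp) (additive-q Mq)) ⟩
    det M⟨ Mp , v ⟩ + det M⟨ Mq , v ⟩                     ≈⟨ sym (additive-p v) ⟩
    det M⟨ v , v ⟩                                        ≈⟨ equal v ⟩
    0#                                                    ∎)
    where
    Mp = M p
    Mq = M q
    v : Fin n → Carrier
    v j = Mp j + Mq j

    M⟨_,_⟩ : (x y : Fin n → Carrier) → Matrix n n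
    M⟨ x , y ⟩ = (M [ p ]≔ x) [ q ]≔ y
    at-p : ∀ x y j → M⟨ x , y ⟩ p j ≈ x j
    at-p x y j = reflexive (≡.cong-app (≡.trans (≔-miss (M [ p ]≔ x) y p≢q) (≔-hit M p x)) j)
    at-q : ∀ x y j → M⟨ x , y ⟩ q j ≈ y j
    at-q x y j = reflexive (≡.cong-app (≔-hit (M [ p ]≔ x) q y) j)
    elsewhere : ∀ x y {i} → i ≢ p → i ≢ q → ∀ j → M⟨ x , y ⟩ i j ≈ M i j
    elsewhere x y i≢p i≢q j = reflexive (≡.cong-app (≡.trans (≔-miss (M [ p ]≔ x) y i≢q) (≔-miss M x i≢p)) j)

    M⟨⟩-unique : ∀ x y (N : Matrix n n) → (∀ j → N p j ≈ x j) → (∀ j → N q j ≈ y j) →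
                 (∀ i → i ≢ p → i ≢ q → ∀ j → N i j ≈ M i j) → M⟨ x , y ⟩ ≈ₘ N
    M⟨⟩-unique x y N Np Nq Ni i j with i ≟ p | i ≟ q
    ... | yes ≡.refl | _          = trans (at-p x y j) (sym (Np j))
    ... | no _       | yes ≡.refl = trans (at-q x y j) (sym (Nq j))
    ... | no i≢p     | no i≢q     = trans (elsewhere x y i≢p i≢q j) (sym (Ni i i≢p i≢q j))

    unchanged : M⟨ Mp , Mq ⟩ ≈ₘ M
    unchanged = M⟨⟩-unique Mp Mq M (λ j → refl) (λ j → refl) (λ i _ _ j → refl)
    swapped : M⟨ Mq , Mp ⟩ ≈ₘ M′
    swapped = M⟨⟩-unique Mq Mp M′ M′p M′q M′i

    equal : ∀ x → det M⟨ x , x ⟩ ≈ 0#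
    equal x = det-equal-rows M⟨ x , x ⟩ p≢q (λ j → trans (at-p x x j) (sym (at-q x x j)))

    M⟨⟩-agree : ∀ {x y x′ y′} i → (i ≡ p → ∀ j → x j ≈ x′ j) → (i ≡ q → ∀ j → y j ≈ y′ j) →
                ∀ j → M⟨ x , y ⟩ i j ≈ M⟨ x′ , y′ ⟩ i j
    M⟨⟩-agree {x} {y} {x′} {y′} i x≈x′ y≈y′ j with i ≟ p | i ≟ q
    ... | yes ≡.refl | _          = trans (at-p x y j) (trans (x≈x′ ≡.refl j) (sym (at-p x′ y′ j)))
    ... | no _       | yes ≡.refl = trans (at-q x y j) (trans (y≈y′ ≡.refl j) (sym (at-q x′ y′ j)))
    ... | no i≢p     | no i≢q     = trans (elsewhere x y i≢p i≢q j) (sym (elsewhere x′ y′ i≢p i≢q j))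

    additive-p : ∀ y → det M⟨ v , y ⟩ ≈ det M⟨ Mp , y ⟩ + det M⟨ Mq , y ⟩
    additive-p y = det-+-row M⟨ v , y ⟩ M⟨ Mp , y ⟩ M⟨ Mq , y ⟩ p off off
      (λ j → trans (at-p v y j) (sym (+-cong (at-p Mp y j) (at-p Mq y j))))
      where
      off : ∀ {x} i → i ≢ p → ∀ j → M⟨ x , y ⟩ i j ≈ M⟨ v , y ⟩ i j
      off i i≢p = M⟨⟩-agree i (⊥-elim ∘ i≢p) (λ _ _ → refl)

    additive-q : ∀ x → det M⟨ x , v ⟩ ≈ det M⟨ x , Mp ⟩ + det M⟨ x , Mq ⟩
    additive-q x = det-+-row M⟨ x , v ⟩ M⟨ x , Mp ⟩ M⟨ x , Mq ⟩ q off off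
      (λ j → trans (at-q x v j) (sym (+-cong (at-q x Mp j) (at-q x Mq j))))
      where
      off : ∀ {y} i → i ≢ q → ∀ j → M⟨ x , y ⟩ i j ≈ M⟨ x , v ⟩ i j
      off i i≢q = M⟨⟩-agree i (λ _ _ → refl) (⊥-elim ∘ i≢q)

  -- If g misses a row index, two rows of B ∘ g coincide (pigeonhole).
  det-missing-row : ∀ {m} (B : Matrix m m) (g : Fin m → Fin m) r → (∀ i → g i ≢ r) → det (B ∘ g) ≈ 0#
  det-missing-row {suc m} B g r missed with pigeonhole (ℕₚ.n<1+n m) (λ i → punchOut (missed i ∘ ≡.sym))
  ... | i , i′ , i<i′ , same = det-equal-rows (B ∘ g) (<⇒≢ᶠ i<i′)
          (λ j → reflexive (≡.cong (λ x → B x j) (punchOut-injective (missed i ∘ ≡.sym) (missed i′ ∘ ≡.sym) same)))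

  -- Bookkeeping for inductions over the length r of an initial segment
  -- {i | toℕ i < r} of Fin m, with d = m - r - 1 indices still to go.
  module Segment {m r d : ℕ} (r+1+d≡m : r ℕ.+ suc d ≡ m) where
    r<m : r ℕ.< m
    r<m = ≡.subst (r ℕ.<_) r+1+d≡m (ℕₚ.m<m+n r (ℕ.s≤s ℕ.z≤n))

    pos : Fin m
    pos = fromℕ< r<m

    grow : suc r ℕ.+ d ≡ m
    grow = ≡.trans (≡.sym (ℕₚ.+-suc r d)) r+1+d≡m

    below⇒≢ : ∀ i → toℕ i ℕ.< r → i ≢ pos
    below⇒≢ i i<r i≡pos = ℕₚ.<⇒≢ i<r (≡.trans (≡.cong toℕ i≡pos) (toℕ-fromℕ< r<m))

    above⇒≢ : ∀ i → r ℕ.< toℕ i → i ≢ pos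
    above⇒≢ i r<i i≡pos = ℕₚ.<⇒≢ r<i (≡.sym (≡.trans (≡.cong toℕ i≡pos) (toℕ-fromℕ< r<m)))

    below-suc : ∀ i → toℕ i ℕ.< suc r → toℕ i ℕ.< r ⊎ i ≡ pos
    below-suc i i<1+r with ℕₚ.m<1+n⇒m<n∨m≡n i<1+r
    ... | inj₁ i<r = inj₁ i<r
    ... | inj₂ i≡r = inj₂ (toℕ-injective (≡.trans i≡r (≡.sym (toℕ-fromℕ< r<m))))

  segment-complete : ∀ {r m} → r ℕ.+ 0 ≡ m → (i : Fin m) → toℕ i ℕ.< r
  segment-complete {r} r+0≡m i = ≡.subst (toℕ i ℕ.<_) (≡.trans (≡.sym r+0≡m) (ℕₚ.+-identityʳ r)) (toℕ<n i)

  -- Induction on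
  -- the length r of an initial segment fixed by g: at index r either g fixes
  -- r already, or r is missed, or g sends some j ≠ r to r, and exchanging the
  -- values of g at r and j (which negates det) extends the fixed segment.
  det-rearranged-singular : ∀ {m} (B : Matrix m m) → det B ≈ 0# → ∀ g → det (B ∘ g) ≈ 0#
  det-rearranged-singular {m} B det≈0 g = fixed-segment m 0 ≡.refl g (λ i ())
    where
    fixed-segment : ∀ d r → r ℕ.+ d ≡ m → ∀ g → (∀ i → toℕ i ℕ.< r → g i ≡ i) → det (B ∘ g) ≈ 0#
    fixed-segment zero r r+0≡m g fixes =
      trans (det-cong (λ i j → reflexive (≡.cong (λ x → B x j) (fixes i (segment-complete r+0≡m i))))) det≈0
    fixed-segment (suc d) r r+1+d≡m g fixes = step (g pos ≟ pos) (any? (λ j → g j ≟ pos))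
      where
      open Segment r+1+d≡m
      step : Dec (g pos ≡ pos) → Dec (∃ λ j → g j ≡ pos) → det (B ∘ g) ≈ 0#
      step (yes g-fixes-pos) _ = fixed-segment d (suc r) grow g fixes′
        where
        fixes′ : ∀ i → toℕ i ℕ.< suc r → g i ≡ i
        fixes′ i i<1+r with below-suc i i<1+r
        ... | inj₁ i<r    = fixes i i<r
        ... | inj₂ ≡.refl = g-fixes-pos
      step (no _) (no none-hits) = det-missing-row B g pos (λ j gj≡pos → none-hits (j , gj≡pos))
      step (no g-moves-pos) (yes (j , gj≡pos)) = begin
        det (B ∘ g)    ≈⟨ det-swap-rows (B ∘ g′) (B ∘ g) pos≢j (row g′-j) (row g′-pos)
                                        (λ i i≢pos i≢j → row (g′-other i≢pos i≢j)) ⟩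
        - det (B ∘ g′) ≈⟨ -‿cong (fixed-segment d (suc r) grow g′ fixes′) ⟩
        - 0#           ≈⟨ -0#≈0# ⟩
        0#             ∎
        where
        pos≢j : pos ≢ j
        pos≢j pos≡j = g-moves-pos (≡.subst (λ x → g x ≡ pos) (≡.sym pos≡j) gj≡pos)
        g′ : Fin m → Fin m
        g′ = (g [ pos ]≔ g j) [ j ]≔ g pos
        g′-pos : g′ pos ≡ g j
        g′-pos = ≡.trans (≔-miss (g [ pos ]≔ g j) (g pos) pos≢j) (≔-hit g pos (g j))
        g′-j : g′ j ≡ g pos
        g′-j = ≔-hit (g [ pos ]≔ g j) j (g pos)
        g′-other : ∀ {i} → i ≢ pos → i ≢ j → g′ i ≡ g i
        g′-other i≢pos i≢j = ≡.trans (≔-miss (g [ pos ]≔ g j) (g pos) i≢j) (≔-miss g (g j) i≢pos)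
        row : ∀ {x y} → x ≡ y → ∀ k → B y k ≈ B x k
        row x≡y k = reflexive (≡.cong (λ x → B x k) (≡.sym x≡y))
        fixes′ : ∀ i → toℕ i ℕ.< suc r → g′ i ≡ i
        fixes′ i i<1+r with below-suc i i<1+r
        ... | inj₂ ≡.refl = ≡.trans g′-pos gj≡pos
        ... | inj₁ i<r = ≡.trans (g′-other (below⇒≢ i i<r) i≢j) (fixes i i<r)
          where
          i≢j : i ≢ j
          i≢j ≡.refl = below⇒≢ i i<r (≡.trans (≡.sym (fixes i i<r)) gj≡pos)

  -- det (X ⊗ B) ≈ 0 whenever det B ≈ 0.  Expanding the rows of X ⊗ B one at
  -- a time by linearity, row i of X ⊗ B being Σ_k X i k * (row k of B),
  -- writes det (X ⊗ B) as a combination of determinants of rearrangements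
  -- B ∘ g, all of which vanish.  Invariant: rows below r of N are rows g i of
  -- B, the remaining rows are those of X ⊗ B.
  det-product-singular : ∀ {m} (X B : Matrix m m) → det B ≈ 0# → det (X ⊗ B) ≈ 0#
  det-product-singular {m} X B det≈0 =
    expanded-segment m 0 ≡.refl (X ⊗ B) (λ i → i) (λ i ()) (λ i _ j → refl)
    where
    expanded-segment : ∀ d r → r ℕ.+ d ≡ m → ∀ (N : Matrix m m) (g : Fin m → Fin m) →
      (∀ i → toℕ i ℕ.< r → ∀ j → N i j ≈ B (g i) j) →
      (∀ i → r ℕ.≤ toℕ i → ∀ j → N i j ≈ (X ⊗ B) i j) → det N ≈ 0#
    expanded-segment zero r r+0≡m N g rows-of-B _ = trans
      (det-cong (λ i → rows-of-B i (segment-complete r+0≡m i))) (det-rearranged-singular B det≈0 g)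
    expanded-segment (suc d) r r+1+d≡m N g rows-of-B rows-of-XB = begin
      det N                          ≈⟨ det-linear-row N pos (X pos) Ns (λ k i i≢pos → replaced-off k i≢pos) row-pos ⟩
      Σ (λ k → X pos k * det (Ns k)) ≈⟨ Σ-zero (λ k → trans (*-cong refl (expanded k)) (zeroʳ _)) ⟩
      0#                             ∎
      where
      open Segment r+1+d≡m
      Ns : Fin m → Matrix m m
      Ns k = N [ pos ]≔ B k
      replaced-at : ∀ k j → Ns k pos j ≈ B k j
      replaced-at k j = reflexive (≡.cong-app (≔-hit N pos (B k)) j)
      replaced-off : ∀ k {i} → i ≢ pos → ∀ j → Ns k i j ≈ N i j
      replaced-off k i≢pos j = reflexive (≡.cong-app (≔-miss N (B k) i≢pos) j)
      row-pos : ∀ j → N pos j ≈ Σ (λ k → X pos k * Ns k pos j)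
      row-pos j = trans (rows-of-XB pos (ℕₚ.≤-reflexive (≡.sym (toℕ-fromℕ< r<m))) j)
                        (Σ-cong (λ k → *-cong refl (sym (replaced-at k j))))
      expanded : ∀ k → det (Ns k) ≈ 0#
      expanded k = expanded-segment d (suc r) grow (Ns k) (g [ pos ]≔ k) rows-of-B′ rows-of-XB′
        where
        rows-of-B′ : ∀ i → toℕ i ℕ.< suc r → ∀ j → Ns k i j ≈ B ((g [ pos ]≔ k) i) j
        rows-of-B′ i i<1+r j with below-suc i i<1+r
        ... | inj₁ i<r = trans (replaced-off k (below⇒≢ i i<r) j) (trans (rows-of-B i i<r j)
                           (reflexive (≡.cong (λ x → B x j) (≡.sym (≔-miss g k (below⇒≢ i i<r))))))
        ... | inj₂ ≡.refl = trans (replaced-at k j) (reflexive (≡.cong (λ x → B x j) (≡.sym (≔-hit g pos k))))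
        rows-of-XB′ : ∀ i → suc r ℕ.≤ toℕ i → ∀ j → Ns k i j ≈ (X ⊗ B) i j
        rows-of-XB′ i r<i j = trans (replaced-off k (above⇒≢ i r<i) j) (rows-of-XB i (ℕₚ.<⇒≤ r<i) j)

  det-identity : ∀ n → det (I {n}) ≈ 1#
  det-identity zero    = refl
  det-identity (suc n) = begin
    1# * (1# * det (I {n})) + Σ (λ j → sign (suc j) * (0# * det (minor (I {suc n}) (suc j))))
      ≈⟨ +-cong (trans (*-identityˡ _) (trans (*-identityˡ _) (det-identity n)))
                (Σ-zero {f = λ j → sign (suc j) * (0# * det (minor (I {suc n}) (suc j)))}
                        (λ j → trans (*-cong refl (zeroˡ _)) (zeroʳ _))) ⟩
    1# + 0#                                                  ≈⟨ +-identityʳ _ ⟩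
    1#                                                       ∎

  -- Inverses of totally unimodular matrices have entries in {-1, 0, 1}.

  unimodular-cong : ∀ {x y} → x ≈ y → Unimodular x → Unimodular y
  unimodular-cong x≈y (inj₁ x≈-1)        = inj₁ (trans (sym x≈y) x≈-1)
  unimodular-cong x≈y (inj₂ (inj₁ x≈0)) = inj₂ (inj₁ (trans (sym x≈y) x≈0))
  unimodular-cong x≈y (inj₂ (inj₂ x≈1)) = inj₂ (inj₂ (trans (sym x≈y) x≈1))

  unimodular-neg : ∀ {x} → Unimodular x → Unimodular (- x)
  unimodular-neg (inj₁ x≈-1)        = inj₂ (inj₂ (trans (-‿cong x≈-1) (-‿involutive _)))
  unimodular-neg (inj₂ (inj₁ x≈0)) = inj₂ (inj₁ (trans (-‿cong x≈0) -0#≈0#))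
  unimodular-neg (inj₂ (inj₂ x≈1)) = inj₁ (-‿cong x≈1)

  unimodular-* : ∀ {x y} → Unimodular x → Unimodular y → Unimodular (x * y)
  unimodular-* {x} {y} (inj₁ x≈-1)        uy = unimodular-cong (sym (trans (*-cong x≈-1 refl) (-1*x≈-x y)))
                                                               (unimodular-neg uy)
  unimodular-* {x} {y} (inj₂ (inj₁ x≈0)) uy = inj₂ (inj₁ (trans (*-cong x≈0 refl) (zeroˡ y)))
  unimodular-* {x} {y} (inj₂ (inj₂ x≈1)) uy = unimodular-cong (sym (trans (*-cong x≈1 refl) (*-identityˡ y))) uy

  unimodular-sign : ∀ {n} (t : Fin n) → Unimodular (sign t)
  unimodular-sign t = go (toℕ t)
    where
    go : ∀ k → Unimodular (sgn k)
    go zero    = inj₂ (inj₂ refl)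
    go (suc k) = unimodular-neg (go k)

  TU-columns : ∀ {m N n} (A : Matrix m N) → TotallyUnimodular A →
               (π : Fin n → Fin N) → Injective _≡_ _≡_ π → TotallyUnimodular (λ i k → A i (π k))
  TU-columns A A-TU π π-inj k rows cols rows-inj cols-inj = A-TU k rows (π ∘ cols) rows-inj (cols-inj ∘ π-inj)

  -- Cramer's rule for column l of a left inverse Binv of B, via the matrix
  -- B⟨ v ⟩ obtained from B by deleting row l and putting v on top.
  module Cramer {n} (B Binv : Matrix (suc n) (suc n)) (left-inverse : (Binv ⊗ B) ≈ₘ I) (l : Fin (suc n)) where

    B⟨_⟩ : (Fin (suc n) → Carrier) → Matrix (suc n) (suc n)
    B⟨ v ⟩ zero    = v
    B⟨ v ⟩ (suc i) = B (punchIn l i)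

    minorₗ cofactor : Fin (suc n) → Carrier
    minorₗ t = det (λ i k → B (punchIn l i) (punchIn t k))
    cofactor t = sign t * minorₗ t

    cofactor-expansion : ∀ v → det B⟨ v ⟩ ≈ Σ (λ t → v t * cofactor t)
    cofactor-expansion v = Σ-cong (λ t → solve 3 (λ S X D → S :* (X :* D) := X :* (S :* D)) refl (sign t) (v t) (minorₗ t))

    -- For q ≠ l the row B q occurs twice in B⟨ B q ⟩.
    other-row : ∀ q → q ≢ l → det B⟨ B q ⟩ ≈ 0#
    other-row q q≢l = det-equal-rows B⟨ B q ⟩ {zero} {suc (punchOut (q≢l ∘ ≡.sym))} (λ ())
      (λ j → reflexive (≡.cong (λ x → B x j) (≡.sym (punchIn-punchOut _))))

    -- B⟨ B l ⟩ is B with row l moved to the top.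
    Δ : Carrier
    Δ = det B⟨ B l ⟩

    -- Multiplying Binv ⊗ B = I by the cofactor vector: cofactor t = Binv t l * Δ.
    cramer : ∀ t → cofactor t ≈ Binv t l * Δ
    cramer t = begin
      cofactor t                                          ≈⟨ sym (Σ-identity t cofactor) ⟩
      Σ (λ j → I t j * cofactor j)
        ≈⟨ Σ-cong {g = λ j → Σ (λ k → Binv t k * B k j) * cofactor j} (λ j → *-cong (sym (left-inverse t j)) refl) ⟩
      Σ (λ j → Σ (λ k → Binv t k * B k j) * cofactor j)
        ≈⟨ Σ-cong (λ j → trans (Σ-*ʳ (cofactor j) (λ k → Binv t k * B k j))
                               (Σ-cong (λ k → *-assoc (Binv t k) (B k j) (cofactor j)))) ⟩
      Σ (λ j → Σ (λ k → Binv t k * (B k j * cofactor j))) ≈⟨ Σ-swap (λ j k → Binv t k * (B k j * cofactor j)) ⟩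
      Σ (λ k → Σ (λ j → Binv t k * (B k j * cofactor j)))
        ≈⟨ Σ-cong (λ k → trans (sym (Σ-*ˡ (Binv t k) (λ j → B k j * cofactor j)))
                               (*-cong refl (sym (cofactor-expansion (B k))))) ⟩
      Σ (λ k → Binv t k * det B⟨ B k ⟩)
        ≈⟨ Σ-single (λ k → Binv t k * det B⟨ B k ⟩) l (λ k k≢l → trans (*-cong refl (other-row k k≢l)) (zeroʳ _)) ⟩
      Binv t l * Δ                                        ∎

    position : Fin (suc n) → Fin (suc n)
    position q with q ≟ l
    ... | yes _   = zero
    ... | no q≢l = suc (punchOut (q≢l ∘ ≡.sym))

    B-rearranged : ∀ q j → B⟨ B l ⟩ (position q) j ≈ B q j
    B-rearranged q j with q ≟ l
    ... | yes ≡.refl = refl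
    ... | no q≢l    = reflexive (≡.cong (λ x → B x j) (punchIn-punchOut _))

    -- If Δ vanished, so would det B and hence det (Binv ⊗ B) = det I = 1.
    Δ≈0⇒1≈0 : Δ ≈ 0# → 1# ≈ 0#
    Δ≈0⇒1≈0 Δ≈0 = begin
      1#               ≈⟨ sym (det-identity (suc n)) ⟩
      det (I {suc n})  ≈⟨ sym (det-cong left-inverse) ⟩
      det (Binv ⊗ B)   ≈⟨ det-product-singular Binv B det-B≈0 ⟩
      0#               ∎
      where
      det-B≈0 : det B ≈ 0#
      det-B≈0 = trans (sym (det-cong B-rearranged)) (det-rearranged-singular B⟨ B l ⟩ Δ≈0 position)

  -- Both Δ and the cofactors are minors of B, hence in {-1, 0, 1}; Cramer's
  -- rule with Δ² = 1 gives Binv t l = cofactor t * Δ.  (If Δ = 0 the ring is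
  -- trivial and every element is 0.)
  inverse-unimodular : ∀ {n} (B Binv : Matrix n n) → TotallyUnimodular B → (Binv ⊗ B) ≈ₘ I →
                       ∀ t l → Unimodular (Binv t l)
  inverse-unimodular {suc n} B Binv B-TU left-inverse t l = from-Δ Δ-unimodular
    where
    open Cramer B Binv left-inverse l
    rows : Fin (suc n) → Fin (suc n)
    rows zero    = l
    rows (suc i) = punchIn l i
    rows-inj : Injective _≡_ _≡_ rows
    rows-inj {zero}  {zero}  _ = ≡.refl
    rows-inj {zero}  {suc j} e = ⊥-elim (punchInᵢ≢i l j (≡.sym e))
    rows-inj {suc i} {zero}  e = ⊥-elim (punchInᵢ≢i l i e)
    rows-inj {suc i} {suc j} e = ≡.cong suc (punchIn-injective l i j e)
    B⟨Bl⟩≈ : (λ i k → B (rows i) k) ≈ₘ B⟨ B l ⟩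
    B⟨Bl⟩≈ zero    k = refl
    B⟨Bl⟩≈ (suc i) k = refl
    Δ-unimodular : Unimodular Δ
    Δ-unimodular = unimodular-cong (det-cong B⟨Bl⟩≈) (B-TU (suc n) rows (λ k → k) rows-inj (λ e → e))
    cofactor-TU : Unimodular (cofactor t)
    cofactor-TU = unimodular-* (unimodular-sign t)
      (B-TU n (punchIn l) (punchIn t) (λ {i} {j} → punchIn-injective l i j) (λ {i} {j} → punchIn-injective t i j))
    via-Δ² : Δ * Δ ≈ 1# → Unimodular (Binv t l)
    via-Δ² Δ²≈1 = unimodular-cong (begin
      cofactor t * Δ          ≈⟨ *-cong (cramer t) refl ⟩
      (Binv t l * Δ) * Δ      ≈⟨ *-assoc _ _ _ ⟩
      Binv t l * (Δ * Δ)      ≈⟨ *-cong refl Δ²≈1 ⟩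
      Binv t l * 1#           ≈⟨ *-identityʳ _ ⟩
      Binv t l                ∎) (unimodular-* cofactor-TU Δ-unimodular)
    from-Δ : Unimodular Δ → Unimodular (Binv t l)
    from-Δ (inj₁ Δ≈-1)        = via-Δ² (trans (*-cong Δ≈-1 Δ≈-1) (trans (neg*neg 1# 1#) (*-identityˡ 1#)))
    from-Δ (inj₂ (inj₂ Δ≈1)) = via-Δ² (trans (*-cong Δ≈1 Δ≈1) (*-identityˡ 1#))
    from-Δ (inj₂ (inj₁ Δ≈0)) = inj₂ (inj₁ (begin
      Binv t l         ≈⟨ sym (*-identityʳ _) ⟩
      Binv t l * 1#    ≈⟨ *-cong refl (Δ≈0⇒1≈0 Δ≈0) ⟩
      Binv t l * 0#    ≈⟨ zeroʳ _ ⟩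
      0#               ∎))

  -- Perturbing the right-hand side of a unimodular system

  ·-difference : ∀ {m n} (M : Matrix m n) (u w : Fin n → Carrier) i →
                 (M · u) i - (M · (λ k → u k - w k)) i ≈ (M · w) i
  ·-difference M u w i = begin
    Σ (λ k → M i k * u k) - Σ (λ k → M i k * (u k - w k))
      ≈⟨ +-cong refl (Σ-neg (λ k → M i k * (u k - w k))) ⟩
    Σ (λ k → M i k * u k) + Σ (λ k → - (M i k * (u k - w k)))
      ≈⟨ sym (Σ-+ (λ k → M i k * u k) (λ k → - (M i k * (u k - w k)))) ⟩
    Σ (λ k → M i k * u k - M i k * (u k - w k))
      ≈⟨ Σ-cong (λ k → cancel (M i k) (u k) (w k)) ⟩
    Σ (λ k → M i k * w k) ∎
    where
    cancel : ∀ a x y → a * x - a * (x - y) ≈ a * y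
    cancel a x y = begin
      a * x - a * (x - y)               ≈⟨ +-cong refl (-‿cong (x[y-z]≈xy-xz a x y)) ⟩
      a * x - (a * x - a * y)           ≈⟨ +-cong refl (sym (-‿+-comm _ _)) ⟩
      a * x + (- (a * x) - - (a * y))   ≈⟨ sym (+-assoc _ _ _) ⟩
      (a * x - a * x) - - (a * y)       ≈⟨ +-cong (-‿inverseʳ _) (-‿involutive _) ⟩
      0# + a * y                        ≈⟨ +-identityˡ _ ⟩
      a * y                             ∎

  Σ-<-average : ∀ {n} (f : Fin (suc n) → Carrier) {Γ} → 0# < Γ →
                (∀ k → (fromℕ (suc n) * f k) < Γ) → Σ f < Γ
  Σ-<-average {n} f {Γ} 0<Γ nf<Γ = *-cancelˡ-< (fromℕ-pos 0<Γ n)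
    (<-respˡ-≈ (sym (Σ-*ˡ (fromℕ (suc n)) f)) (<-respʳ-≈ (Σ-const (suc n) Γ) (Σ-mono-< nf<Γ)))

  -- A matrix with entries in {-1, 0, 1} maps a vector w with
  -- n * ∣w k∣ < Γ (n its length) to a vector whose entries square below Γ²:
  -- each entry lies within ± Σ ∣w k∣, which is below Γ.
  unimodular-image-small : ∀ {m n} (M : Matrix m (suc n)) → (∀ i k → Unimodular (M i k)) →
    ∀ {Γ} → 0# < Γ → (w : Fin (suc n) → Carrier) → (∀ k → (fromℕ (suc n) * ∣ w k ∣) < Γ) →
    ∀ i → ((M · w) i * (M · w) i) < (Γ * Γ)
  unimodular-image-small M M-unimodular 0<Γ w small i =
    square-< (<-≼-trans (neg-antitone-< S<Γ) lower) (≼-<-trans upper S<Γ)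
    where
    S = Σ (λ k → ∣ w k ∣)
    S<Γ = Σ-<-average (λ k → ∣ w k ∣) 0<Γ small
    lower : (- S) ≼ (M · w) i
    lower = ≼-respˡ-≈ (sym (Σ-neg (λ k → ∣ w k ∣)))
              (Σ-mono-≼ (λ k → proj₁ (unimodular-scale (w k) (M-unimodular i k))))
    upper : (M · w) i ≼ S
    upper = Σ-mono-≼ (λ k → proj₂ (unimodular-scale (w k) (M-unimodular i k)))

corollary2p8 : {c ℓ₁ ℓ₂ : Level} (F : OrderedField c ℓ₁ ℓ₂) →
    let open OrderedField F in
    let open Ops F in
    (m N : ℕ) → 1 ≤ m →
    (A : Matrix m N) → TotallyUnimodular A → FullRowRank A →
    (b : Fin m → ℤ) →
    (Γ : Carrier) → 0# < Γ →
    (γ : Fin m → Carrier) → (∀ i → (fromℕ m * ∣ γ i ∣) < Γ) →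
    (π : Fin m → Fin N) → (∀ {i j} → π i ≡ π j → i ≡ j) →
    (Binv : Matrix m m) →
    ((λ i k → A i (π k)) ⊗ Binv) ≈ₘ I → (Binv ⊗ (λ i k → A i (π k))) ≈ₘ I →
    (x̂ x′ : Fin N → Carrier) →
    (∀ i → x̂ (π i) ≈ (Binv · (λ k → fromℤ (b k))) i) →
    (∀ i → x′ (π i) ≈ (Binv · (λ k → fromℤ (b k) - γ k)) i) →
    (∀ j → (∀ i → ¬ (π i ≡ j)) → x̂ j ≈ 0#) →
    (∀ j → (∀ i → ¬ (π i ≡ j)) → x′ j ≈ 0#) →
    Σ (λ j → (x̂ j - x′ j) * (x̂ j - x′ j)) < ((fromℕ m * Γ) * Γ)
corollary2p8 F (suc m) N _ A A-TU _ b Γ 0<Γ γ γ-small π π-inj Binv _ Binv-left x̂ x′ x̂-basic x′-basic x̂-off x′-off =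
  begin-strict
    Σ (λ j → d j * d j)                   ≈⟨ Σ-image π π-inj (λ j → d j * d j) off-basis ⟩
    Σ (λ i → d (π i) * d (π i))           ≈⟨ Σ-cong (λ i → *-cong (on-basis i) (on-basis i)) ⟩
    Σ (λ i → (Binv · γ) i * (Binv · γ) i) <⟨ Σ-mono-< (unimodular-image-small Binv Binv-unimodular 0<Γ γ γ-small) ⟩
    Σ {suc m} (λ _ → Γ * Γ)               ≈⟨ Σ-const (suc m) (Γ * Γ) ⟩
    fromℕ (suc m) * (Γ * Γ)               ≈⟨ sym (*-assoc _ _ _) ⟩
    (fromℕ (suc m) * Γ) * Γ               ∎
  where
  open OrderedField F
  open Ops F
  open OrderedFieldLinearAlgebra F
  open OrderReasoning strictPartialOrder
  open RingProperties ring using (-0#≈0#)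
  d : Fin N → Carrier
  d j = x̂ j - x′ j
  off-basis : ∀ j → (∀ i → ¬ (π i ≡ j)) → d j * d j ≈ 0#
  off-basis j off = trans (*-cong (refl {d j}) d≈0) (zeroʳ (d j))
    where
    d≈0 : d j ≈ 0#
    d≈0 = trans (+-cong (x̂-off j off) (trans (-‿cong (x′-off j off)) -0#≈0#)) (+-identityˡ 0#)
  on-basis : ∀ i → d (π i) ≈ (Binv · γ) i
  on-basis i = trans (+-cong (x̂-basic i) (-‿cong (x′-basic i))) (·-difference Binv (λ k → fromℤ (b k)) γ i)
  Binv-unimodular : ∀ t l → Unimodular (Binv t l)
  Binv-unimodular = inverse-unimodular (λ i k → A i (π k)) Binv (TU-columns A A-TU π π-inj) Binv-left
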